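{- Let $G$ be a graph of connectivity $k$, let $Q$ be a spanning tree of $G$, and set $\mathfrak{S}:=\{V(e):\, e\in E(Q)\}$. Suppose that every $\mathfrak{S}$-fragment has cardinality at least $\frac{k-1}{2}$, and let $B$ be an $\mathfrak{S}$-end. Then $|B|=\frac{k-1}{2}$ (in particular $k$ is odd), or every edge $e$ of $Q$ with $|V(e)\cap B|=1$ is $k$-contractible.
   Context: All graphs are finite, simple and undirected. $G$ is $k$-connected if $|V(G)|>k$ and $G-T$ is connected for all $T\subseteq V(G)$ with $|T|<k$; the connectivity $\kappa(G)$ is the largest $k$ with $G$ $k$-connected. An edge $e$ of a $k$-connected graph is $k$-contractible if the graph $G/e$ (identify the endvertices of $e$ and simplify) is $k$-connected. A smallest separating set is a $T\subseteq V(G)$ with $|T|=\kappa(G)$ and $G-T$ disconnected; $\mathfrak{T}(G)$ is the set of these. For $T\in\mathfrak{T}(G)$, a $T$-fragment is the union of the vertex sets of at least one but not all components of $G-T$ (then $T=N_G(F)$). For a family $\mathfrak{S}$ of vertex subsets, a $T$-fragment $F$ is a $T$-$\mathfrak{S}$-fragment if $S\subseteq T$ for some $S\in\mathfrak{S}$; an $\mathfrak{S}$-fragment is a $T$-$\mathfrak{S}$-fragment for some $T\in\mathfrak{T}(G)$; an $\mathfrak{S}$-end is an $\mathfrak{S}$-fragment that properly contains no other $\mathfrak{S}$-fragment. -}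

module Defs where

open import Data.Nat using (ℕ; suc; _<_; _≤_; _+_; _*_) public
open import Data.Fin using (Fin; _≟_) public
open import Data.Fin.Subset using (Subset; _∈_; _∉_; _⊆_; _⊂_; ∁; ⁅_⁆; ∣_∣; ⊤) public
open import Data.Bool using (Bool; true; false; _∨_; _∧_) public
open import Data.List using (List; []; _∷_; length) public
open import Data.List.Relation.Unary.Unique.Propositional using (Unique) public
open import Data.Product using (Σ; ∃; ∃-syntax; _×_; _,_) public
open import Data.Sum using (_⊎_) public
open import Relation.Nullary using (¬_; ⌊_⌋) public
open import Relation.Binary.PropositionalEquality using (_≡_) public

record Graph (n : ℕ) : Set where
  field
    adj    : Fin n → Fin n → Bool
    sym    : ∀ x y → adj x y ≡ adj y x
    irrefl : ∀ x → adj x x ≡ false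
open Graph public

Adj : Set → Set
Adj V = V → V → Bool

data Reach {n : ℕ} (A : Adj (Fin n)) (W : Subset n) : Fin n → Fin n → Set where
  here : ∀ {x} → x ∈ W → Reach A W x x
  step : ∀ {x y z} → x ∈ W → A x y ≡ true → Reach A W y z → Reach A W x z

ConnectedOn : {n : ℕ} → Adj (Fin n) → Subset n → Set
ConnectedOn A W = ∀ x y → x ∈ W → y ∈ W → Reach A W x y

KConnectedOn : {n : ℕ} → Adj (Fin n) → Subset n → ℕ → Set
KConnectedOn {n} A W k =
  (k < ∣ W ∣) × (∀ (T : Subset n) → T ⊆ W → ∣ T ∣ < k → ConnectedOn A (W ∖ T))
  where
  _∖_ : Subset n → Subset n → Subset n
  X ∖ Y = Data.Fin.Subset._∩_ X (∁ Y)

KConnected : {n : ℕ} → Graph n → ℕ → Set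
KConnected {n} G k = KConnectedOn (adj G) ⊤ k

ConnectivityIs : {n : ℕ} → Graph n → ℕ → Set
ConnectivityIs G k = KConnected G k × ¬ KConnected G (suc k)

-- The contraction G/e of the edge e = uv: realised (up to isomorphism) as the
-- graph on vertex set V(G) ∖ {v}, where u represents the merged vertex and is
-- adjacent to N(u) ∪ N(v); other adjacencies are those of G.
contractAdj : {n : ℕ} → Graph n → Fin n → Fin n → Adj (Fin n)
contractAdj G u v x y =
  adj G x y ∨ ((⌊ x ≟ u ⌋ ∧ adj G v y) ∨ (⌊ y ≟ u ⌋ ∧ adj G x v))

contractVerts : {n : ℕ} → Fin n → Subset n
contractVerts v = ∁ ⁅ v ⁆

KContractible : {n : ℕ} → Graph n → Fin n → Fin n → ℕ → Set
KContractible G u v k = KConnectedOn (contractAdj G u v) (contractVerts v) k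

Path : {n : ℕ} → Adj (Fin n) → List (Fin n) → Set
Path A [] = ⊤'
  where open import Data.Unit using () renaming (⊤ to ⊤')
Path A (x ∷ []) = Data.Unit.⊤
  where import Data.Unit
Path A (x ∷ y ∷ xs) = (A x y ≡ true) × Path A (y ∷ xs)

IsCycle : {n : ℕ} → Adj (Fin n) → List (Fin n) → Set
IsCycle A [] = Data.Empty.⊥
  where import Data.Empty
IsCycle A (x ∷ xs) =
  (3 ≤ length (x ∷ xs)) × Unique (x ∷ xs) × Path A (x ∷ xs) × (A (last x xs) x ≡ true)
  where
  last : Fin _ → List (Fin _) → Fin _
  last y [] = y
  last y (z ∷ zs) = last z zs

record SpanningTree {n : ℕ} (G : Graph n) : Set where
  field
    tadj      : Adj (Fin n)
    tsym      : ∀ x y → tadj x y ≡ tadj y x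
    tirrefl   : ∀ x → tadj x x ≡ false
    sub       : ∀ x y → tadj x y ≡ true → adj G x y ≡ true
    connected : ConnectedOn tadj ⊤
    acyclic   : ∀ (c : List (Fin n)) → ¬ IsCycle tadj c
open SpanningTree public

SmallestSep : {n : ℕ} → Graph n → ℕ → Subset n → Set
SmallestSep G k T = (∣ T ∣ ≡ k) × ¬ ConnectedOn (adj G) (∁ T)

-- F is a T-fragment: the union of the vertex sets of at least one but not all
-- components of G - T, i.e. a nonempty subset of V ∖ T, closed under
-- adjacency inside G - T, and not all of V ∖ T.
IsFragment : {n : ℕ} → Graph n → Subset n → Subset n → Set
IsFragment G T F =
  (∀ {x} → x ∈ F → x ∉ T)
  × (∃[ x ] x ∈ F)
  × (∃[ y ] (y ∉ T × y ∉ F))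
  × (∀ x y → x ∈ F → y ∉ T → adj G x y ≡ true → y ∈ F)

-- 𝔖 = {V(e) : e ∈ E(Q)}; T contains some member of 𝔖.
ContainsTreeEdge : {n : ℕ} {G : Graph n} → SpanningTree G → Subset n → Set
ContainsTreeEdge Q T = ∃[ u ] ∃[ v ] (tadj Q u v ≡ true × u ∈ T × v ∈ T)

SFragment : {n : ℕ} (G : Graph n) → SpanningTree G → ℕ → Subset n → Set
SFragment {n} G Q k F =
  ∃[ T ] (SmallestSep G k T × IsFragment G T F × ContainsTreeEdge Q T)

SEnd : {n : ℕ} (G : Graph n) → SpanningTree G → ℕ → Subset n → Set
SEnd G Q k B = SFragment G Q k B × (∀ F → SFragment G Q k F → ¬ (F ⊂ B))

module Submission where

-- Let B be an 𝔖-end with separating set T, write B′ = V - (B ∪ T), and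
-- assume k < 2|B| + 1.  Let uv be a tree edge with u ∈ B, v ∉ B; then
-- v ∈ T.  If G/uv had a separating set T′ with |T′| < k, then u ∈ T′
-- (otherwise G - T′ is already connected and maps onto G/uv - T′), so
-- S = T′ ∪ {v} is a smallest separating set of G containing the tree
-- edge uv; let C be an S-fragment and D = V - (C ∪ S).  Each nonempty
-- corner X ∩ Y (X ∈ {B, B′}, Y ∈ {C, D}) is a fragment of the corner set
-- (T ∩ Y) ∪ (S ∩ T) ∪ (S ∩ X), which therefore has at least k vertices,
-- and more than k when X = B because B is an end.  Comparing these
-- bounds with |S| = |T| = k and the hypothesis on fragment sizes shows
-- that B ⊆ S and 2|B| + 1 ≤ k, a contradiction.

open import Defs hiding (sym)
open import Data.Nat using (zero; z≤n) renaming (_≤?_ to _≤ℕ?_)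
open import Data.Nat.Properties
  using ( +-suc; +-comm; ≤-trans; ≤-antisym; <⇒≤; <⇒≱; ≰⇒>; ≤∧≢⇒<; <-irrefl
        ; ≤-<-trans; ≤-total; +-mono-≤; +-monoˡ-≤; +-monoʳ-≤; +-mono-≤-<; *-monoʳ-≤; m≤m+n
        ; +-cancelˡ-≡; +-cancelˡ-≤; +-cancelʳ-≤; +-cancelˡ-<; m≤n⇒m<n∨m≡n; module ≤-Reasoning )
open import Data.Nat.Tactic.RingSolver using (solve-∀)
open import Data.Bool.Properties using (∨-zeroʳ) renaming (_≟_ to _≟𝔹_)
open import Data.Vec using ([]; _∷_)
open import Data.Vec.Base using (here; there)
open import Data.Fin.Subset using (_∪_; _∩_; Nonempty)
open import Data.Fin.Subset.Properties
  using ( _∈?_; nonempty?; ∈⊤; ⊆⊤; ∣⊤∣≡n; x∈⁅x⁆; x∈⁅y⁆⇒x≡y; x≢y⇒x∉⁅y⁆; ∣⁅x⁆∣≡1; ⊆-antisym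
        ; p⊆q⇒∣p∣≤∣q∣; p⊂q⇒∣p∣<∣q∣; x∈p⇒∣p-x∣<∣p∣; x∈p⇒x∉∁p; x∈∁p⇒x∉p; x∉p⇒x∈∁p; p∪∁p≡⊤
        ; ∩-comm; ∩-identityˡ; p∩q⊆p; p∩q⊆q; x∈p∩q⁺; x∈p∩q⁻; p⊆p∪q; q⊆p∪q; x∈p∪q⁺; x∈p∪q⁻ )
open import Data.Fin.Properties using (any?)
open import Data.Empty using (⊥; ⊥-elim)
open import Data.Product using (proj₁; proj₂)
open import Data.Sum using (inj₁; inj₂; [_,_])
open import Relation.Nullary using (Dec; yes; no; ¬?; _×-dec_)
open import Relation.Binary.PropositionalEquality
  using (_≢_; refl; sym; trans; cong; subst; subst₂; ≡-≟-identity; module ≡-Reasoning)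

Disjoint : {n : ℕ} → Subset n → Subset n → Set
Disjoint p q = ∀ {x} → x ∈ p → x ∉ q

∣∪∣-disjoint : {n : ℕ} (p q : Subset n) → Disjoint p q → ∣ p ∪ q ∣ ≡ ∣ p ∣ + ∣ q ∣
∣∪∣-disjoint []          []          _ = refl
∣∪∣-disjoint (true ∷ p)  (true ∷ q)  d = ⊥-elim (d here here)
∣∪∣-disjoint (true ∷ p)  (false ∷ q) d = cong suc (∣∪∣-disjoint p q (λ x∈p x∈q → d (there x∈p) (there x∈q)))
∣∪∣-disjoint (false ∷ p) (true ∷ q)  d =
  trans (cong suc (∣∪∣-disjoint p q (λ x∈p x∈q → d (there x∈p) (there x∈q)))) (sym (+-suc ∣ p ∣ ∣ q ∣))
∣∪∣-disjoint (false ∷ p) (false ∷ q) d = ∣∪∣-disjoint p q (λ x∈p x∈q → d (there x∈p) (there x∈q))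

∣p∣+∣∁p∣ : {n : ℕ} (p : Subset n) → ∣ p ∣ + ∣ ∁ p ∣ ≡ n
∣p∣+∣∁p∣ {n} p = trans (sym (∣∪∣-disjoint p (∁ p) x∈p⇒x∉∁p)) (trans (cong ∣_∣ (p∪∁p≡⊤ p)) (∣⊤∣≡n n))

inhabited⇒positive : {n : ℕ} {p : Subset n} {x : Fin n} → x ∈ p → 1 ≤ ∣ p ∣
inhabited⇒positive x∈p = ≤-<-trans z≤n (x∈p⇒∣p-x∣<∣p∣ x∈p)

-- The vertices outside both F and T; for a T-fragment F this is the
-- union of the remaining components of G - T.
opposite : {n : ℕ} → Subset n → Subset n → Subset n
opposite T F = ∁ F ∩ ∁ T

opposite⁺ : {n : ℕ} {T F : Subset n} {x : Fin n} → x ∉ F → x ∉ T → x ∈ opposite T F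
opposite⁺ x∉F x∉T = x∈p∩q⁺ (x∉p⇒x∈∁p x∉F , x∉p⇒x∈∁p x∉T)

opposite⁻ : {n : ℕ} {T F : Subset n} {x : Fin n} → x ∈ opposite T F → x ∉ F × x ∉ T
opposite⁻ {T = T} {F} x∈O with x∈p∩q⁻ (∁ F) (∁ T) x∈O
... | x∈∁F , x∈∁T = x∈∁p⇒x∉p x∈∁F , x∈∁p⇒x∉p x∈∁T

∣∣-split : {n : ℕ} {F T : Subset n} → Disjoint F T → (X : Subset n) →
           ∣ X ∣ ≡ ∣ X ∩ F ∣ + (∣ X ∩ T ∣ + ∣ X ∩ opposite T F ∣)
∣∣-split {n} {F} {T} F∩T=∅ X = begin
  ∣ X ∣                                                ≡⟨ cong ∣_∣ (⊆-antisym into-pieces from-pieces) ⟩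
  ∣ (X ∩ F) ∪ ((X ∩ T) ∪ (X ∩ O)) ∣                    ≡⟨ ∣∪∣-disjoint _ _ F-apart ⟩
  ∣ X ∩ F ∣ + ∣ (X ∩ T) ∪ (X ∩ O) ∣                    ≡⟨ cong (∣ X ∩ F ∣ +_) (∣∪∣-disjoint _ _ T-apart) ⟩
  ∣ X ∩ F ∣ + (∣ X ∩ T ∣ + ∣ X ∩ O ∣)                  ∎
  where
  open ≡-Reasoning
  O : Subset n
  O = opposite T F
  into-pieces : X ⊆ (X ∩ F) ∪ ((X ∩ T) ∪ (X ∩ O))
  into-pieces {z} z∈X with z ∈? F | z ∈? T
  ... | yes z∈F | _       = x∈p∪q⁺ (inj₁ (x∈p∩q⁺ (z∈X , z∈F)))
  ... | no _    | yes z∈T = x∈p∪q⁺ (inj₂ (x∈p∪q⁺ (inj₁ (x∈p∩q⁺ (z∈X , z∈T)))))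
  ... | no z∉F  | no z∉T  = x∈p∪q⁺ (inj₂ (x∈p∪q⁺ (inj₂ (x∈p∩q⁺ (z∈X , opposite⁺ z∉F z∉T)))))
  from-pieces : (X ∩ F) ∪ ((X ∩ T) ∪ (X ∩ O)) ⊆ X
  from-pieces {z} z∈ with x∈p∪q⁻ _ _ z∈
  ... | inj₁ z∈X∩F = p∩q⊆p X F z∈X∩F
  ... | inj₂ z∈rest = [ p∩q⊆p X T , p∩q⊆p X O ] (x∈p∪q⁻ _ _ z∈rest)
  F-apart : Disjoint (X ∩ F) ((X ∩ T) ∪ (X ∩ O))
  F-apart z∈X∩F z∈rest with x∈p∪q⁻ _ _ z∈rest
  ... | inj₁ z∈X∩T = F∩T=∅ (p∩q⊆q X F z∈X∩F) (p∩q⊆q X T z∈X∩T)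
  ... | inj₂ z∈X∩O = proj₁ (opposite⁻ (p∩q⊆q X O z∈X∩O)) (p∩q⊆q X F z∈X∩F)
  T-apart : Disjoint (X ∩ T) (X ∩ O)
  T-apart z∈X∩T z∈X∩O = proj₂ (opposite⁻ (p∩q⊆q X O z∈X∩O)) (p∩q⊆q X T z∈X∩T)

size-inside : {n : ℕ} {S X Y : Subset n} → Disjoint X Y → Disjoint X (opposite S Y) → ∣ X ∣ ≤ ∣ S ∩ X ∣
size-inside {S = S} {X} {Y} X∩Y=∅ X∩O=∅ = p⊆q⇒∣p∣≤∣q∣ X⊆S∩X
  where
  X⊆S∩X : X ⊆ S ∩ X
  X⊆S∩X {z} z∈X with z ∈? S | z ∈? Y
  ... | yes z∈S | _       = x∈p∩q⁺ (z∈S , z∈X)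
  ... | no _    | yes z∈Y = ⊥-elim (X∩Y=∅ z∈X z∈Y)
  ... | no z∉S  | no z∉Y  = ⊥-elim (X∩O=∅ z∈X (opposite⁺ z∉Y z∉S))

empty⇒disjoint : {n : ℕ} {X Y : Subset n} → ¬ Nonempty (X ∩ Y) → Disjoint X Y
empty⇒disjoint empty z∈X z∈Y = empty (_ , x∈p∩q⁺ (z∈X , z∈Y))

∉∪⁺ : {n : ℕ} {p q : Subset n} {z : Fin n} → z ∉ p → z ∉ q → z ∉ p ∪ q
∉∪⁺ {p = p} {q} z∉p z∉q z∈p∪q = [ z∉p , z∉q ] (x∈p∪q⁻ p q z∈p∪q)

∈∁∪⁻ : {n : ℕ} {p q : Subset n} {z : Fin n} → z ∈ ∁ (p ∪ q) → z ∉ p × z ∉ q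
∈∁∪⁻ {p = p} {q} z∈ = (λ z∈p → x∈∁p⇒x∉p z∈ (p⊆p∪q q z∈p)) , (λ z∈q → x∈∁p⇒x∉p z∈ (q⊆p∪q p q z∈q))

∣∪⁅x⁆∣ : {n : ℕ} (p : Subset n) {x : Fin n} → x ∉ p → ∣ p ∪ ⁅ x ⁆ ∣ ≡ suc ∣ p ∣
∣∪⁅x⁆∣ p {x} x∉p = begin
  ∣ p ∪ ⁅ x ⁆ ∣      ≡⟨ ∣∪∣-disjoint p ⁅ x ⁆ (λ z∈p z∈⁅x⁆ → x∉p (subst (_∈ p) (x∈⁅y⁆⇒x≡y x z∈⁅x⁆) z∈p)) ⟩
  ∣ p ∣ + ∣ ⁅ x ⁆ ∣  ≡⟨ cong (∣ p ∣ +_) (∣⁅x⁆∣≡1 x) ⟩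
  ∣ p ∣ + 1          ≡⟨ +-comm ∣ p ∣ 1 ⟩
  suc ∣ p ∣          ∎
  where open ≡-Reasoning

walk-start : {n : ℕ} {A : Adj (Fin n)} {W : Subset n} {x y : Fin n} → Reach A W x y → x ∈ W
walk-start (here x∈W)     = x∈W
walk-start (step x∈W _ _) = x∈W

walk-end : {n : ℕ} {A : Adj (Fin n)} {W : Subset n} {x y : Fin n} → Reach A W x y → y ∈ W
walk-end (here y∈W)    = y∈W
walk-end (step _ _ r)  = walk-end r

walk-snoc : {n : ℕ} {A : Adj (Fin n)} {W : Subset n} {x z y : Fin n} →
            Reach A W x z → A z y ≡ true → y ∈ W → Reach A W x y
walk-snoc (here x∈W)       e y∈W = step x∈W e (here y∈W)
walk-snoc (step x∈W e′ r)  e y∈W = step x∈W e′ (walk-snoc r e y∈W)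

walk-closed : {n : ℕ} {A : Adj (Fin n)} {W : Subset n} (X : Subset n) →
              (∀ {z z′} → z ∈ X → z′ ∈ W → A z z′ ≡ true → z′ ∈ X) →
              {x y : Fin n} → Reach A W x y → x ∈ X → y ∈ X
walk-closed X closed (here _)     x∈X = x∈X
walk-closed X closed (step _ e r) x∈X = walk-closed X closed r (closed x∈X (walk-start r) e)

walk-map : {n : ℕ} {A A′ : Adj (Fin n)} {W W′ : Subset n} (f : Fin n → Fin n) →
           (∀ {z} → z ∈ W → f z ∈ W′) →
           (∀ {z z′} → A z z′ ≡ true → A′ (f z) (f z′) ≡ true) →
           {x y : Fin n} → Reach A W x y → Reach A′ W′ (f x) (f y)
walk-map f inside edge (here x∈W)     = here (inside x∈W)
walk-map f inside edge (step x∈W e r) = step (inside x∈W) (edge e) (walk-map f inside edge r)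

record Component {n : ℕ} (A : Adj (Fin n)) (W : Subset n) (x : Fin n) : Set where
  field
    members   : Subset n
    root      : x ∈ members
    reachable : ∀ {y} → y ∈ members → Reach A W x y
    closed    : ∀ {z y} → z ∈ members → y ∈ W → A z y ≡ true → y ∈ members

-- Every vertex of W has a component; it is found by repeatedly adding a
-- neighbour outside the current set, which can happen at most n times.
component : {n : ℕ} (A : Adj (Fin n)) (W : Subset n) {x : Fin n} → x ∈ W → Component A W x
component {n} A W {x} x∈W =
  grow n ⁅ x ⁆ (m≤m+n n ∣ ⁅ x ⁆ ∣) (x∈⁅x⁆ x)
       (λ {y} y∈⁅x⁆ → subst (Reach A W x) (sym (x∈⁅y⁆⇒x≡y x y∈⁅x⁆)) (here x∈W))
  where
  Exit : Subset n → Set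
  Exit R = ∃[ z ] ∃[ y ] (z ∈ R × y ∈ W × y ∉ R × A z y ≡ true)

  exit? : (R : Subset n) → Dec (Exit R)
  exit? R = any? λ z → any? λ y → z ∈? R ×-dec y ∈? W ×-dec ¬? (y ∈? R) ×-dec A z y ≟𝔹 true

  grow : (fuel : ℕ) (R : Subset n) → n ≤ fuel + ∣ R ∣ → x ∈ R →
         (∀ {y} → y ∈ R → Reach A W x y) → Component A W x
  grow fuel R bound x∈R reach with exit? R
  grow fuel R bound x∈R reach | no stuck =
    record { members = R ; root = x∈R ; reachable = reach ; closed = closed }
    where
    closed : ∀ {z y} → z ∈ R → y ∈ W → A z y ≡ true → y ∈ R
    closed {z} {y} z∈R y∈W e with y ∈? R
    ... | yes y∈R = y∈R
    ... | no y∉R  = ⊥-elim (stuck (z , y , z∈R , y∈W , y∉R , e))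
  grow zero R bound x∈R reach | yes (_ , y , _ , _ , y∉R , _) =
    ⊥-elim (<⇒≱ (subst (∣ R ∣ <_) (∣⊤∣≡n n) (p⊂q⇒∣p∣<∣q∣ (⊆⊤ , y , ∈⊤ , y∉R))) bound)
  grow (suc fuel) R bound x∈R reach | yes (z , y , z∈R , y∈W , y∉R , e) =
    grow fuel (R ∪ ⁅ y ⁆) bound′ (p⊆p∪q ⁅ y ⁆ x∈R) reach′
    where
    bound′ : n ≤ fuel + ∣ R ∪ ⁅ y ⁆ ∣
    bound′ = subst (n ≤_) (sym (trans (cong (fuel +_) (∣∪⁅x⁆∣ R y∉R)) (+-suc fuel ∣ R ∣))) bound
    reach′ : ∀ {w} → w ∈ R ∪ ⁅ y ⁆ → Reach A W x w
    reach′ {w} w∈ with x∈p∪q⁻ R ⁅ y ⁆ w∈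
    ... | inj₁ w∈R   = reach w∈R
    ... | inj₂ w∈⁅y⁆ = subst (Reach A W x) (sym (x∈⁅y⁆⇒x≡y y w∈⁅y⁆)) (walk-snoc (reach z∈R) e y∈W)

component-fragment : {n : ℕ} {G : Graph n} {S : Subset n} {x y : Fin n} →
                     (c : Component (adj G) (∁ S) x) → y ∉ S → y ∉ Component.members c →
                     IsFragment G S (Component.members c)
component-fragment {G = G} {S} {x} {y} c y∉S y∉C = avoid , (x , root) , (y , y∉S , y∉C) , close
  where
  open Component c
  avoid : ∀ {z} → z ∈ members → z ∉ S
  avoid z∈C = x∈∁p⇒x∉p (walk-end (reachable z∈C))
  close : ∀ z z′ → z ∈ members → z′ ∉ S → adj G z z′ ≡ true → z′ ∈ members
  close z z′ z∈C z′∉S e = closed z∈C (x∉p⇒x∈∁p z′∉S) e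

reach-or-fragment : {n : ℕ} (G : Graph n) {S : Subset n} {x y : Fin n} → x ∉ S → y ∉ S →
                    Reach (adj G) (∁ S) x y ⊎ ∃[ C ] IsFragment G S C
reach-or-fragment G {S} {x} {y} x∉S y∉S with component (adj G) (∁ S) (x∉p⇒x∈∁p x∉S)
... | c with y ∈? Component.members c
...   | yes y∈C = inj₁ (Component.reachable c y∈C)
...   | no y∉C  = inj₂ (_ , component-fragment {G = G} c y∉S y∉C)

fragment-walk : {n : ℕ} {G : Graph n} {T F W : Subset n} {x y : Fin n} → IsFragment G T F →
                (∀ {z} → z ∈ W → z ∉ T) → Reach (adj G) W x y → x ∈ F → y ∈ F
fragment-walk {F = F} (_ , _ , _ , closed) W∩T=∅ =
  walk-closed F (λ {z} {z′} z∈F z′∈W e → closed z z′ z∈F (W∩T=∅ z′∈W) e)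

fragment-disconnects : {n : ℕ} {G : Graph n} {T F : Subset n} → IsFragment G T F → ¬ ConnectedOn (adj G) (∁ T)
fragment-disconnects {G = G} {T} frag@(avoid , (x , x∈F) , (y , y∉T , y∉F) , _) connected =
  y∉F (fragment-walk {G = G} {T} frag x∈∁p⇒x∉p (connected x y (x∉p⇒x∈∁p (avoid x∈F)) (x∉p⇒x∈∁p y∉T)) x∈F)

removed⁻ : {n : ℕ} {T : Subset n} {z : Fin n} → z ∈ ⊤ ∩ ∁ T → z ∉ T
removed⁻ {T = T} z∈ = x∈∁p⇒x∉p (p∩q⊆q ⊤ (∁ T) z∈)

removal-walk : {n k : ℕ} {G : Graph n} {T : Subset n} {x y : Fin n} → KConnected G k →
               ∣ T ∣ < k → x ∉ T → y ∉ T → Reach (adj G) (⊤ ∩ ∁ T) x y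
removal-walk {T = T} {x} {y} (_ , connected) small x∉T y∉T =
  connected T ⊆⊤ small x y (x∈p∩q⁺ (∈⊤ , x∉p⇒x∈∁p x∉T)) (x∈p∩q⁺ (∈⊤ , x∉p⇒x∈∁p y∉T))

separator-size : {n k : ℕ} {G : Graph n} {T F : Subset n} → KConnected G k → IsFragment G T F → k ≤ ∣ T ∣
separator-size {k = k} {G} {T} kc frag@(avoid , (x , x∈F) , (y , y∉T , y∉F) , _) with k ≤ℕ? ∣ T ∣
... | yes large = large
... | no small   = ⊥-elim (y∉F (fragment-walk {G = G} {T} frag removed⁻ (removal-walk {G = G} {T = T} kc (≰⇒> small) (avoid x∈F) y∉T) x∈F))

opposite-fragment : {n : ℕ} {G : Graph n} {T F : Subset n} → IsFragment G T F → IsFragment G T (opposite T F)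
opposite-fragment {G = G} {T} {F} (avoid , (x , x∈F) , (y , y∉T , y∉F) , closed) =
  (λ z∈O → proj₂ (opposite⁻ z∈O)) , (y , opposite⁺ y∉F y∉T) ,
  (x , avoid x∈F , λ x∈O → proj₁ (opposite⁻ x∈O) x∈F) , close
  where
  close : ∀ z z′ → z ∈ opposite T F → z′ ∉ T → adj G z z′ ≡ true → z′ ∈ opposite T F
  close z z′ z∈O z′∉T e = opposite⁺ z′∉F z′∉T
    where
    -- z′ ∈ F would pull its neighbour z into F.
    z′∉F : z′ ∉ F
    z′∉F z′∈F = proj₁ (opposite⁻ z∈O) (closed z′ z z′∈F (proj₂ (opposite⁻ z∈O)) (trans (Graph.sym G z′ z) e))

s-fragment : {n k : ℕ} {G : Graph n} {Q : SpanningTree G} {T F : Subset n} →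
             ∣ T ∣ ≡ k → IsFragment G T F → ContainsTreeEdge Q T → SFragment G Q k F
s-fragment {G = G} {Q = Q} {T = T} size frag edge = T , (size , fragment-disconnects {G = G} frag) , frag , edge

-- A set with a fragment leaves at least two vertices outside, so it is
-- smaller than G with one vertex deleted.
separator-below-order : {n : ℕ} {G : Graph n} {T F : Subset n} → IsFragment G T F → (v : Fin n) →
                        ∣ T ∣ < ∣ ∁ ⁅ v ⁆ ∣
separator-below-order {n} {T = T} {F} (avoid , (x , x∈F) , (y , y∉T , y∉F) , _) v =
  +-cancelˡ-≤ 1 _ _ (begin
    1 + suc ∣ T ∣                                        ≡⟨ cong suc (+-comm 1 ∣ T ∣) ⟩
    1 + (∣ T ∣ + 1)                                      ≤⟨ +-mono-≤ F-positive (+-monoʳ-≤ ∣ T ∣ O-positive) ⟩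
    ∣ ⊤ ∩ F ∣ + (∣ T ∣ + ∣ ⊤ ∩ opposite T F ∣)           ≡⟨ cong (λ m → ∣ ⊤ ∩ F ∣ + (m + ∣ ⊤ ∩ opposite T F ∣)) (sym (cong ∣_∣ (∩-identityˡ T))) ⟩
    ∣ ⊤ ∩ F ∣ + (∣ ⊤ ∩ T ∣ + ∣ ⊤ ∩ opposite T F ∣)       ≡⟨ sym (∣∣-split avoid ⊤) ⟩
    ∣ ⊤ {n} ∣                                            ≡⟨ ∣⊤∣≡n n ⟩
    n                                                    ≡⟨ sym (∣p∣+∣∁p∣ ⁅ v ⁆) ⟩
    ∣ ⁅ v ⁆ ∣ + ∣ ∁ ⁅ v ⁆ ∣                              ≡⟨ cong (_+ ∣ ∁ ⁅ v ⁆ ∣) (∣⁅x⁆∣≡1 v) ⟩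
    1 + ∣ ∁ ⁅ v ⁆ ∣                                      ∎)
  where
  open ≤-Reasoning
  F-positive : 1 ≤ ∣ ⊤ ∩ F ∣
  F-positive = inhabited⇒positive (x∈p∩q⁺ (∈⊤ , x∈F))
  O-positive : 1 ≤ ∣ ⊤ ∩ opposite T F ∣
  O-positive = inhabited⇒positive (x∈p∩q⁺ (∈⊤ , opposite⁺ y∉F y∉T))

-- For a T-fragment X and an S-fragment Y, the corner set that cuts the
-- corner X ∩ Y off from the rest of the graph.
corner : {n : ℕ} → Subset n → Subset n → Subset n → Subset n → Subset n
corner T S X Y = (T ∩ Y) ∪ ((S ∩ T) ∪ (S ∩ X))

corner⁻ : {n : ℕ} {T S X Y : Subset n} {z : Fin n} → z ∈ corner T S X Y →
          z ∈ T ⊎ (z ∈ S × z ∈ X)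
corner⁻ {T = T} {S} {X} {Y} z∈K with x∈p∪q⁻ _ _ z∈K
... | inj₁ z∈T∩Y  = inj₁ (p∩q⊆p T Y z∈T∩Y)
... | inj₂ z∈rest with x∈p∪q⁻ _ _ z∈rest
...   | inj₁ z∈S∩T = inj₁ (p∩q⊆q S T z∈S∩T)
...   | inj₂ z∈S∩X = inj₂ (x∈p∩q⁻ S X z∈S∩X)

corner-fragment : {n : ℕ} {G : Graph n} {T S X Y : Subset n} →
                  IsFragment G T X → IsFragment G S Y → Nonempty (X ∩ Y) →
                  IsFragment G (corner T S X Y) (X ∩ Y)
corner-fragment {G = G} {T} {S} {X} {Y} (avoidT , _ , (y , y∉T , y∉X) , closedX) (avoidS , _ , _ , closedY) (x , x∈X∩Y) =
  inside-avoids , (x , x∈X∩Y) , (y , outside-avoids , λ y∈X∩Y → y∉X (p∩q⊆p X Y y∈X∩Y)) , closed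
  where
  inside-avoids : ∀ {z} → z ∈ X ∩ Y → z ∉ corner T S X Y
  inside-avoids z∈X∩Y z∈K with x∈p∩q⁻ X Y z∈X∩Y | corner⁻ {Y = Y} z∈K
  ... | z∈X , _   | inj₁ z∈T       = avoidT z∈X z∈T
  ... | _   , z∈Y | inj₂ (z∈S , _) = avoidS z∈Y z∈S
  outside-avoids : y ∉ corner T S X Y
  outside-avoids y∈K with corner⁻ {Y = Y} y∈K
  ... | inj₁ y∈T       = y∉T y∈T
  ... | inj₂ (_ , y∈X) = y∉X y∈X
  closed : ∀ z z′ → z ∈ X ∩ Y → z′ ∉ corner T S X Y → adj G z z′ ≡ true → z′ ∈ X ∩ Y
  closed z z′ z∈X∩Y z′∉K e with x∈p∩q⁻ X Y z∈X∩Y | z′ ∈? T | z′ ∈? S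
  ... | _ | yes z′∈T | yes z′∈S =
    ⊥-elim (z′∉K (x∈p∪q⁺ (inj₂ (x∈p∪q⁺ (inj₁ (x∈p∩q⁺ (z′∈S , z′∈T)))))))
  ... | _ , z∈Y | yes z′∈T | no z′∉S =
    ⊥-elim (z′∉K (x∈p∪q⁺ (inj₁ (x∈p∩q⁺ (z′∈T , closedY z z′ z∈Y z′∉S e)))))
  ... | z∈X , _ | no z′∉T | yes z′∈S =
    ⊥-elim (z′∉K (x∈p∪q⁺ (inj₂ (x∈p∪q⁺ (inj₂ (x∈p∩q⁺ (z′∈S , closedX z z′ z∈X z′∉T e)))))))
  ... | z∈X , z∈Y | no z′∉T | no z′∉S = x∈p∩q⁺ (closedX z z′ z∈X z′∉T e , closedY z z′ z∈Y z′∉S e)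

-- The three parts of the corner set are disjoint.
corner-size : {n : ℕ} {G : Graph n} {T S X Y : Subset n} → IsFragment G T X → IsFragment G S Y →
              ∣ corner T S X Y ∣ ≡ ∣ T ∩ Y ∣ + (∣ S ∩ T ∣ + ∣ S ∩ X ∣)
corner-size {T = T} {S} {X} {Y} (avoidT , _) (avoidS , _) =
  trans (∣∪∣-disjoint _ _ Y-apart) (cong (∣ T ∩ Y ∣ +_) (∣∪∣-disjoint _ _ T-apart))
  where
  Y-apart : Disjoint (T ∩ Y) ((S ∩ T) ∪ (S ∩ X))
  Y-apart z∈T∩Y z∈rest = avoidS (p∩q⊆q T Y z∈T∩Y) ([ p∩q⊆p S T , p∩q⊆p S X ] (x∈p∪q⁻ _ _ z∈rest))
  T-apart : Disjoint (S ∩ T) (S ∩ X)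
  T-apart z∈S∩T z∈S∩X = avoidT (p∩q⊆q S X z∈S∩X) (p∩q⊆q S T z∈S∩T)

-- Sizes of separating sets are written x + (s + y), the middle part s
-- being |S ∩ T|.  Comparing such a size with another one sharing x and s
-- compares the last parts.
cancel-≤ : ∀ {x s y z k} → x + (s + y) ≡ k → k ≤ x + (s + z) → y ≤ z
cancel-≤ {x} {s} refl k≤ = +-cancelˡ-≤ s _ _ (+-cancelˡ-≤ x _ _ k≤)

cancel-< : ∀ {x s y z k} → x + (s + y) ≡ k → k < x + (s + z) → y < z
cancel-< {x} {s} refl k< = +-cancelˡ-< s _ _ (+-cancelˡ-< x _ _ k<)

swap-ends : ∀ {x s y k} → x + (s + y) ≡ k → y + (s + x) ≡ k
swap-ends {x} {s} {y} = trans (ends x s y)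
  where
  ends : ∀ x s y → y + (s + x) ≡ x + (s + y)
  ends = solve-∀

drop-middle : ∀ {x s y z w} → x + (s + y) ≡ z + (s + w) → x + y ≡ z + w
drop-middle {x} {s} {y} {z} {w} eq = +-cancelˡ-≡ s _ _ (trans (middle x s y) (trans eq (sym (middle z s w))))
  where
  middle : ∀ x s y → s + (x + y) ≡ x + (s + y)
  middle = solve-∀

half-≤ : ∀ {x s y k} → x + (s + y) ≡ k → 1 ≤ s → k ≤ 2 * y + 1 → x ≤ y
half-≤ {x} {s} {y} refl s≥1 k≤ = +-cancelʳ-≤ (1 + y) x y (begin
  x + (1 + y)  ≤⟨ +-monoʳ-≤ x (+-monoˡ-≤ y s≥1) ⟩
  x + (s + y)  ≤⟨ k≤ ⟩
  2 * y + 1    ≡⟨ double y ⟩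
  y + (1 + y)  ∎)
  where
  open ≤-Reasoning
  double : ∀ y → 2 * y + 1 ≡ y + (1 + y)
  double = solve-∀

half-bound : ∀ {x s y k} → x + (s + y) ≡ k → 1 ≤ s → x ≤ y → 2 * x + 1 ≤ k
half-bound {x} {s} {y} refl s≥1 x≤y = begin
  2 * x + 1    ≡⟨ double x ⟩
  x + (1 + x)  ≤⟨ +-monoʳ-≤ x (+-mono-≤ s≥1 x≤y) ⟩
  x + (s + y)  ∎
  where
  open ≤-Reasoning
  double : ∀ x → 2 * x + 1 ≡ x + (1 + x)
  double = solve-∀

crossing : ∀ {a b c d} → d < a → c ≤ b → a + b ≡ c + d → ⊥
crossing {a} {b} {c} {d} d<a c≤b eq = <-irrefl (sym (trans (+-comm b a) eq)) (+-mono-≤-< c≤b d<a)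

above-both : ∀ {a b c d} → c ≤ b → d ≤ b → a + b ≡ c + d → a ≤ b
above-both {a} {b} c≤b d≤b eq = +-cancelʳ-≤ b a b (subst (_≤ b + b) (sym eq) (+-mono-≤ c≤b d≤b))

halve : ∀ {c b} → c + c ≤ b + b → c ≤ b
halve {c} {b} le with ≤-total c b
... | inj₁ c≤b = c≤b
... | inj₂ b≤c = +-cancelʳ-≤ c c b (≤-trans le (+-monoʳ-≤ b b≤c))

-- If a ≤ b and c ≤ d, then c is at most the mean (a + b)/2 ≤ b.
mean-bound : ∀ {a b c d} → a ≤ b → c ≤ d → a + b ≡ c + d → c ≤ b
mean-bound {a} {b} {c} a≤b c≤d eq = halve (≤-trans (+-monoʳ-≤ c c≤d) (subst (_≤ b + b) eq (+-monoˡ-≤ b a≤b)))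

-- The information gathered about the four corners B ∩ C, B ∩ D, B′ ∩ C,
-- B′ ∩ D (the propositions say that the corner is nonempty), in terms of
-- a = |S ∩ B|, b = |S ∩ B′|, c = |T ∩ C|, d = |T ∩ D|.
record CornerInequalities (a b c d : ℕ) (BC BD B′C B′D : Set) : Set where
  field
    BC?        : Dec BC
    BD?        : Dec BD
    B′C?       : Dec B′C
    B′D?       : Dec B′D
    balanced   : a + b ≡ c + d
    BC-bound   : BC → d < a
    BD-bound   : BD → c < a
    B′C-bound  : B′C → d ≤ b
    B′D-bound  : B′D → c ≤ b
    B′-inside  : ¬ B′C → ¬ B′D → a ≤ b
    C-inside   : ¬ BC → ¬ B′C → d ≤ c
    D-inside   : ¬ BD → ¬ B′D → c ≤ d

mirror : ∀ {a b c d BC BD B′C B′D} → CornerInequalities a b c d BC BD B′C B′D →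
         CornerInequalities a b d c BD BC B′D B′C
mirror {c = c} {d} I = record
  { BC? = BD? ; BD? = BC? ; B′C? = B′D? ; B′D? = B′C?
  ; balanced = trans balanced (+-comm c d)
  ; BC-bound = BD-bound ; BD-bound = BC-bound
  ; B′C-bound = B′D-bound ; B′D-bound = B′C-bound
  ; B′-inside = λ ¬B′D ¬B′C → B′-inside ¬B′C ¬B′D
  ; C-inside = D-inside ; D-inside = C-inside }
  where open CornerInequalities I

-- c ≤ b: directly if B′ ∩ D is nonempty; otherwise via c < a (if B ∩ D is
-- nonempty) or c ≤ d (if D lies in T), together with a ≤ b or d ≤ b.
c≤b : ∀ {a b c d BC BD B′C B′D} → CornerInequalities a b c d BC BD B′C B′D → c ≤ b
c≤b {b = b} {c} {d} {BD = BD} {B′C} {B′D} I = by-cases B′D? B′C? BD?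
  where
  open CornerInequalities I
  by-cases : Dec B′D → Dec B′C → Dec BD → c ≤ b
  by-cases (yes p) _       _       = B′D-bound p
  by-cases (no ¬p) (yes q) (yes r) = ⊥-elim (crossing (BD-bound r) (B′C-bound q) (trans balanced (+-comm c d)))
  by-cases (no ¬p) (yes q) (no ¬r) = ≤-trans (D-inside ¬r ¬p) (B′C-bound q)
  by-cases (no ¬p) (no ¬q) (yes r) = ≤-trans (<⇒≤ (BD-bound r)) (B′-inside ¬q ¬p)
  by-cases (no ¬p) (no ¬q) (no ¬r) = mean-bound (B′-inside ¬q ¬p) (D-inside ¬r ¬p) balanced

-- By symmetry also d ≤ b; hence both B-corners are empty and a ≤ b.
corner-conclusion : ∀ {a b c d BC BD B′C B′D} → CornerInequalities a b c d BC BD B′C B′D →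
                    ¬ BC × ¬ BD × a ≤ b
corner-conclusion {b = b} {c} {d} I =
  (λ p → crossing (BC-bound p) c≤b′ balanced) ,
  (λ p → crossing (BD-bound p) d≤b (trans balanced (+-comm c d))) ,
  above-both c≤b′ d≤b balanced
  where
  open CornerInequalities I
  c≤b′ : c ≤ b
  c≤b′ = c≤b I
  d≤b : d ≤ b
  d≤b = c≤b (mirror I)

module EndCrossing {n k : ℕ} {G : Graph n} {Q : SpanningTree G} {B T S C : Subset n} {u v : Fin n}
  (kc : KConnected G k) (large-fragments : ∀ F → SFragment G Q k F → k ≤ 2 * ∣ F ∣ + 1)
  (end : ∀ F → SFragment G Q k F → ¬ (F ⊂ B))
  (T-size : ∣ T ∣ ≡ k) (fB : IsFragment G T B) (T-edge : ContainsTreeEdge Q T)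
  (uv : tadj Q u v ≡ true) (u∈B : u ∈ B) (v∈T : v ∈ T)
  (S-size : ∣ S ∣ ≡ k) (fC : IsFragment G S C) (u∈S : u ∈ S) (v∈S : v ∈ S)
  where

  B′ D : Subset n
  B′ = opposite T B
  D  = opposite S C

  fB′ : IsFragment G T B′
  fB′ = opposite-fragment {G = G} fB

  fD : IsFragment G S D
  fD = opposite-fragment {G = G} fC

  S-edge : ContainsTreeEdge Q S
  S-edge = u , v , uv , u∈S , v∈S

  a b s c d : ℕ
  a = ∣ S ∩ B ∣
  b = ∣ S ∩ B′ ∣
  s = ∣ S ∩ T ∣
  c = ∣ T ∩ C ∣
  d = ∣ T ∩ D ∣

  S-split : a + (s + b) ≡ k
  S-split = trans (sym (∣∣-split (proj₁ fB) S)) S-size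

  T-split : c + (s + d) ≡ k
  T-split = begin
    c + (s + d)            ≡⟨ cong (λ m → c + (m + d)) (cong ∣_∣ (∩-comm S T)) ⟩
    c + (∣ T ∩ S ∣ + d)    ≡⟨ sym (∣∣-split (proj₁ fC) T) ⟩
    ∣ T ∣                  ≡⟨ T-size ⟩
    k                      ∎
    where open ≡-Reasoning

  s-positive : 1 ≤ s
  s-positive = inhabited⇒positive (x∈p∩q⁺ (v∈S , v∈T))

  corner-bound : ∀ {X Y} → IsFragment G T X → IsFragment G S Y → Nonempty (X ∩ Y) →
                 k ≤ ∣ T ∩ Y ∣ + (s + ∣ S ∩ X ∣)
  corner-bound fX fY ne =
    subst (k ≤_) (corner-size {G = G} fX fY) (separator-size {G = G} kc (corner-fragment {G = G} fX fY ne))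

  -- For X = B the corner set contains the tree edge uv, so k vertices
  -- would make B ∩ Y an 𝔖-fragment properly inside the end B.
  end-corner-bound : ∀ {Y} → IsFragment G S Y → Nonempty (B ∩ Y) → k < ∣ T ∩ Y ∣ + (s + a)
  end-corner-bound {Y} fY ne = ≤∧≢⇒< (corner-bound fB fY ne) not-tight
    where
    in-corner : ∀ {z} → z ∈ S ∩ T ⊎ z ∈ S ∩ B → z ∈ corner T S B Y
    in-corner z∈ = x∈p∪q⁺ (inj₂ (x∈p∪q⁺ z∈))
    smaller : B ∩ Y ⊂ B
    smaller = p∩q⊆p B Y , u , u∈B , λ u∈B∩Y → proj₁ fY (p∩q⊆q B Y u∈B∩Y) u∈S
    not-tight : k ≢ ∣ T ∩ Y ∣ + (s + a)
    not-tight tight = end (B ∩ Y)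
      (s-fragment {G = G} {Q = Q} (trans (corner-size {G = G} fB fY) (sym tight)) (corner-fragment {G = G} fB fY ne)
                  (u , v , uv , in-corner (inj₂ (x∈p∩q⁺ (u∈S , u∈B))) , in-corner (inj₁ (x∈p∩q⁺ (v∈S , v∈T)))))
      smaller

  B′-bound : k ≤ 2 * ∣ B′ ∣ + 1
  B′-bound = large-fragments B′ (s-fragment {G = G} {Q = Q} T-size fB′ T-edge)

  C-bound : k ≤ 2 * ∣ C ∣ + 1
  C-bound = large-fragments C (s-fragment {G = G} {Q = Q} S-size fC S-edge)

  D-bound : k ≤ 2 * ∣ D ∣ + 1
  D-bound = large-fragments D (s-fragment {G = G} {Q = Q} S-size fD S-edge)

  double-mono : ∀ {x y} → x ≤ y → k ≤ 2 * x + 1 → k ≤ 2 * y + 1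
  double-mono x≤y k≤ = ≤-trans k≤ (+-monoˡ-≤ 1 (*-monoʳ-≤ 2 x≤y))

  -- The corner bounds, rewritten in terms of a, b, c, d; a fragment that
  -- meets neither side of the other separating set lies inside it.
  corners : CornerInequalities a b c d (Nonempty (B ∩ C)) (Nonempty (B ∩ D)) (Nonempty (B′ ∩ C)) (Nonempty (B′ ∩ D))
  corners = record
    { BC? = nonempty? (B ∩ C) ; BD? = nonempty? (B ∩ D) ; B′C? = nonempty? (B′ ∩ C) ; B′D? = nonempty? (B′ ∩ D)
    ; balanced  = drop-middle {a} {s} {b} {c} (trans S-split (sym T-split))
    ; BC-bound  = λ ne → cancel-< {c} {s} T-split (end-corner-bound fC ne)
    ; BD-bound  = λ ne → cancel-< {d} {s} (swap-ends {c} {s} T-split) (end-corner-bound fD ne)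
    ; B′C-bound = λ ne → cancel-≤ {c} {s} T-split (corner-bound fB′ fC ne)
    ; B′D-bound = λ ne → cancel-≤ {d} {s} (swap-ends {c} {s} T-split) (corner-bound fB′ fD ne)
    ; B′-inside = λ ¬B′C ¬B′D → half-≤ {a} {s} S-split s-positive
        (double-mono (size-inside {S = S} (empty⇒disjoint ¬B′C) (empty⇒disjoint ¬B′D)) B′-bound)
    ; C-inside  = λ ¬BC ¬B′C → half-≤ {d} {s} (swap-ends {c} {s} T-split) s-positive
        (double-mono (size-inside {S = T} (flip-empty ¬BC) (flip-empty ¬B′C)) C-bound)
    ; D-inside  = λ ¬BD ¬B′D → half-≤ {c} {s} T-split s-positive
        (double-mono (size-inside {S = T} (flip-empty ¬BD) (flip-empty ¬B′D)) D-bound)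
    }
    where
    flip-empty : ∀ {X Y} → ¬ Nonempty (X ∩ Y) → Disjoint Y X
    flip-empty empty z∈Y z∈X = empty⇒disjoint empty z∈X z∈Y

  -- Both B-corners are empty, so B ⊆ S and |B| ≤ a ≤ b.
  end-crossing : 2 * ∣ B ∣ + 1 ≤ k
  end-crossing with corner-conclusion corners
  ... | ¬BC , ¬BD , a≤b =
    ≤-trans (+-monoˡ-≤ 1 (*-monoʳ-≤ 2 (size-inside {S = S} (empty⇒disjoint ¬BC) (empty⇒disjoint ¬BD))))
            (half-bound {a} {s} S-split s-positive a≤b)

true≢false : true ≢ false
true≢false ()

module _ {n : ℕ} (G : Graph n) (u v : Fin n) where

  contract-keeps : ∀ {x y} → adj G x y ≡ true → contractAdj G u v x y ≡ true
  contract-keeps e rewrite e = refl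

  contract-from-v : ∀ {y} → adj G v y ≡ true → contractAdj G u v u y ≡ true
  contract-from-v {y} e rewrite ≡-≟-identity _≟_ {u} refl | e = ∨-zeroʳ (adj G u y)

  contract-into-v : ∀ {z} → adj G z v ≡ true → contractAdj G u v z u ≡ true
  contract-into-v {z} e rewrite ≡-≟-identity _≟_ {u} refl | e =
    trans (cong (adj G z u ∨_) (∨-zeroʳ _)) (∨-zeroʳ (adj G z u))

  merge : Fin n → Fin n
  merge z with z ≟ v
  ... | yes _ = u
  ... | no _  = z

  merge-edge : ∀ {z z′} → adj G z z′ ≡ true → contractAdj G u v (merge z) (merge z′) ≡ true
  merge-edge {z} {z′} e with z ≟ v | z′ ≟ v
  ... | yes refl | yes refl = ⊥-elim (true≢false (trans (sym e) (irrefl G v)))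
  ... | yes refl | no _     = contract-from-v e
  ... | no _     | yes refl = contract-into-v e
  ... | no _     | no _     = contract-keeps e

  merge-fixed : ∀ {z} → z ∉ ⁅ v ⁆ → merge z ≡ z
  merge-fixed {z} z∉v with z ≟ v
  ... | yes refl = ⊥-elim (z∉v (x∈⁅x⁆ v))
  ... | no _     = refl

  merge-inside : ∀ {T z} → u ≢ v → u ∉ T → z ∉ T → merge z ∈ opposite T ⁅ v ⁆
  merge-inside {z = z} u≢v u∉T z∉T with z ≟ v
  ... | yes _   = opposite⁺ (x≢y⇒x∉⁅y⁆ u≢v) u∉T
  ... | no z≢v  = opposite⁺ (x≢y⇒x∉⁅y⁆ z≢v) z∉T

  merged-walk : ∀ {T x y} → u ≢ v → u ∉ T → x ∉ ⁅ v ⁆ → y ∉ ⁅ v ⁆ →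
                Reach (adj G) (⊤ ∩ ∁ T) x y → Reach (contractAdj G u v) (opposite T ⁅ v ⁆) x y
  merged-walk {T} u≢v u∉T x∉v y∉v walk =
    subst₂ (Reach (contractAdj G u v) (opposite T ⁅ v ⁆)) (merge-fixed x∉v) (merge-fixed y∉v)
      (walk-map merge (λ z∈ → merge-inside u≢v u∉T (removed⁻ z∈)) merge-edge walk)

  lifted-walk : ∀ {T x y} → Reach (adj G) (∁ (T ∪ ⁅ v ⁆)) x y → Reach (contractAdj G u v) (opposite T ⁅ v ⁆) x y
  lifted-walk = walk-map (λ z → z) (λ z∈ → opposite⁺ (proj₂ (∈∁∪⁻ z∈)) (proj₁ (∈∁∪⁻ z∈))) contract-keeps

end-edges-contractible : {n k : ℕ} {G : Graph n} {Q : SpanningTree G} {B : Subset n} →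
  KConnected G k → (∀ F → SFragment G Q k F → k ≤ 2 * ∣ F ∣ + 1) → SEnd G Q k B →
  k < 2 * ∣ B ∣ + 1 → ∀ u v → tadj Q u v ≡ true → u ∈ B → v ∉ B → KContractible G u v k
end-edges-contractible {n} {k} {G} {Q} {B} kc large-fragments ((T , (T-size , _) , fB , T-edge) , end) large u v uv u∈B v∉B =
  more-vertices , stays-connected
  where
  u≢v : u ≢ v
  u≢v refl = true≢false (trans (sym uv) (tirrefl Q u))

  -- v is a neighbour of the fragment B outside it, so v ∈ T.
  v∈T : v ∈ T
  v∈T with v ∈? T
  ... | yes v∈T = v∈T
  ... | no v∉T  = ⊥-elim (v∉B (proj₂ (proj₂ (proj₂ fB)) u v u∈B v∉T (sub Q u v uv)))

  more-vertices : k < ∣ ∁ ⁅ v ⁆ ∣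
  more-vertices = subst (_< ∣ ∁ ⁅ v ⁆ ∣) T-size (separator-below-order {G = G} fB v)

  -- Deleting fewer than k vertices from G/uv leaves it connected: if u
  -- survives, walks of G - T′ map to G/uv - T′; otherwise S = T′ ∪ {v}
  -- either leaves G connected, or is a smallest separating set of G
  -- containing the tree edge uv, which the crossing lemma rules out.
  stays-connected : ∀ T′ → T′ ⊆ ∁ ⁅ v ⁆ → ∣ T′ ∣ < k → ConnectedOn (contractAdj G u v) (opposite T′ ⁅ v ⁆)
  stays-connected T′ T′⊆ small x y x∈ y∈ with opposite⁻ x∈ | opposite⁻ y∈ | u ∈? T′
  ... | x∉v , x∉T′ | y∉v , y∉T′ | no u∉T′ =
    merged-walk G u v u≢v u∉T′ x∉v y∉v (removal-walk {G = G} {T = T′} kc small x∉T′ y∉T′)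
  ... | x∉v , x∉T′ | y∉v , y∉T′ | yes u∈T′ with reach-or-fragment G (∉∪⁺ x∉T′ x∉v) (∉∪⁺ y∉T′ y∉v)
  ...   | inj₁ walk     = lifted-walk G u v walk
  ...   | inj₂ (C , fC) = ⊥-elim (<⇒≱ large (EndCrossing.end-crossing
      {G = G} {Q = Q} {B = B} {T = T} {S = T′ ∪ ⁅ v ⁆} {C = C} kc large-fragments end T-size fB T-edge
      uv u∈B v∈T S-size fC (p⊆p∪q ⁅ v ⁆ u∈T′) (q⊆p∪q T′ ⁅ v ⁆ (x∈⁅x⁆ v))))
    where
    -- |S| = |T′| + 1 ≤ k, and S has a fragment, so |S| = k.
    S-size : ∣ T′ ∪ ⁅ v ⁆ ∣ ≡ k
    S-size = ≤-antisym (subst (_≤ k) (sym (∣∪⁅x⁆∣ T′ (λ v∈T′ → x∈∁p⇒x∉p (T′⊆ v∈T′) (x∈⁅x⁆ v)))) small) (separator-size {G = G} kc fC)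

-- The hypothesis gives k ≤ 2|B| + 1; equality is the first alternative,
-- and strict inequality makes every tree edge leaving B contractible.
theorem7 : ∀ {n : ℕ} (G : Graph n) (k : ℕ) → ConnectivityIs G k →
    (Q : SpanningTree G) →
    (∀ F → SFragment G Q k F → k ≤ 2 * ∣ F ∣ + 1) →
    (B : Subset n) → SEnd G Q k B →
    (2 * ∣ B ∣ + 1 ≡ k)
    ⊎ (∀ u v → tadj Q u v ≡ true → u ∈ B → v ∉ B → KContractible G u v k)
theorem7 G k (kc , _) Q large-fragments B end with m≤n⇒m<n∨m≡n (large-fragments B (proj₁ end))
... | inj₁ large = inj₂ (end-edges-contractible {G = G} {Q = Q} kc large-fragments end large)
... | inj₂ tight = inj₁ (sym tight)
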